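{- Let $G$ be a column continuous subgrid of $P_n\times P_n$ and let $M$ be a perfect matching of $G$ containing an $(i,j,k)$-bracket. Let $T=\{(a,b) \mid i\le a\le i+2k+1,\ j\le b\le n\}\cap V(G)$. Then $M$ can be transformed, by a sequence of matching 2-switches each involving only edges with both endpoints in $T$, into a perfect matching of $G$ containing the edges $\{(i,j),(i+1,j)\},\{(i+2,j),(i+3,j)\},\dots,\{(i+2k,j),(i+2k+1,j)\}$.
   Context: The vertices of the grid $P_n\times P_n$ are labelled $(i,j)$, $1\le i,j\le n$, where $i$ is the row and $j$ the column; $(i,j)$ and $(i',j')$ are adjacent iff $|i-i'|+|j-j'|=1$. An induced subgraph $G$ of the grid is a column continuous subgrid if whenever $(i_1,j),(i_2,j)\in V(G)$, then $(i,j)\in V(G)$ for all integers $i$ with $i_1\le i\le i_2$. For integers $k\ge0$, an $(i,j,k)$-bracket in a perfect matching $M$ of $G$ is a set of edges of $M$ of the form $\{\{(i,j),(i,j+1)\},\{(i+1,j),(i+2,j)\},\{(i+3,j),(i+4,j)\},\dots,\{(i+2k-1,j),(i+2k,j)\},\{(i+2k+1,j),(i+2k+1,j+1)\}\}$. A matching 2-switch: if $e_1=\{u_1,v_1\}$, $e_2=\{u_2,v_2\}\in M$ and $\{u_1,u_2\},\{v_1,v_2\}$ are edges of $G$, replace $e_1,e_2$ in $M$ by $\{u_1,u_2\},\{v_1,v_2\}$. -}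

module Defs where

open import Level using (Level; 0ℓ) renaming (suc to lsuc)
open import Data.Nat using (ℕ; zero; suc; _+_; _*_; _≤_; _<_)
open import Data.Product using (Σ; ∃; _×_; _,_)
open import Data.Sum using (_⊎_)
open import Relation.Nullary using (¬_)
open import Relation.Binary.PropositionalEquality using (_≡_)
open import Function.Bundles using (_⇔_)
open import Relation.Binary.Construct.Closure.ReflexiveTransitive using (Star)

-- A vertex (i , j) : row i, column j.
Vertex : Set
Vertex = ℕ × ℕ

InGrid : ℕ → Vertex → Set
InGrid n (i , j) = (1 ≤ i × i ≤ n) × (1 ≤ j × j ≤ n)

Adj : Vertex → Vertex → Set
Adj (i , j) (i' , j') =
  (i ≡ i' × (j' ≡ suc j ⊎ j ≡ suc j')) ⊎ (j ≡ j' × (i' ≡ suc i ⊎ i ≡ suc i'))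

-- An induced subgraph of P_n × P_n, given by its vertex set.
record Subgrid (n : ℕ) : Set₁ where
  field
    V      : Vertex → Set
    inGrid : ∀ v → V v → InGrid n v
open Subgrid public

EdgeOf : ∀ {n} → Subgrid n → Vertex → Vertex → Set
EdgeOf G u v = V G u × V G v × Adj u v

ColumnContinuous : ∀ {n} → Subgrid n → Set
ColumnContinuous G = ∀ i₁ i₂ j i → V G (i₁ , j) → V G (i₂ , j) →
  i₁ ≤ i → i ≤ i₂ → V G (i , j)

-- A set of edges, represented as a symmetric relation on vertices:
-- M u v means the edge {u,v} belongs to the set.
EdgeSet : Set₁
EdgeSet = Vertex → Vertex → Set

record PerfectMatching {n : ℕ} (G : Subgrid n) (M : EdgeSet) : Set where
  field
    sym     : ∀ u v → M u v → M v u
    edges   : ∀ u v → M u v → EdgeOf G u v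
    perfect : ∀ u → V G u → Σ Vertex λ v → M u v × (∀ w → M u w → w ≡ v)

SameEdge : Vertex → Vertex → Vertex → Vertex → Set
SameEdge x y u v = (x ≡ u × y ≡ v) ⊎ (x ≡ v × y ≡ u)

Switch : ∀ {n} → Subgrid n → (Vertex → Set) → EdgeSet → EdgeSet → Set
Switch G T M M' = Σ Vertex λ u₁ → Σ Vertex λ v₁ → Σ Vertex λ u₂ → Σ Vertex λ v₂ →
  M u₁ v₁ × M u₂ v₂ × ¬ SameEdge u₁ v₁ u₂ v₂ ×
  EdgeOf G u₁ u₂ × EdgeOf G v₁ v₂ ×
  T u₁ × T v₁ × T u₂ × T v₂ ×
  (∀ x y → M' x y ⇔
     ((M x y × ¬ SameEdge x y u₁ v₁ × ¬ SameEdge x y u₂ v₂)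
       ⊎ SameEdge x y u₁ u₂ ⊎ SameEdge x y v₁ v₂))

HasBracket : EdgeSet → ℕ → ℕ → ℕ → Set
HasBracket M i j k =
  M (i , j) (i , suc j) ×
  (∀ t → t < k → M (i + 2 * t + 1 , j) (i + 2 * t + 2 , j)) ×
  M (i + 2 * k + 1 , j) (i + 2 * k + 1 , suc j)

TRegion : ∀ {n} → Subgrid n → ℕ → ℕ → ℕ → Vertex → Set
TRegion {n} G i j k (a , b) = (i ≤ a × a ≤ i + 2 * k + 1) × (j ≤ b × b ≤ n) × V G (a , b)

HasVerticalColumn : EdgeSet → ℕ → ℕ → ℕ → Set
HasVerticalColumn M i j k = ∀ t → t ≤ k → M (i + 2 * t , j) (i + 2 * t + 1 , j)

module Submission where

-- Induction on the width w of the grid to the right of column j (n ≤ j + w), and for fixed width on k.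
-- For k = 0 the bracket is a unit square of two horizontal edges, which one switch makes vertical.
-- For k > 0 look at the partner of (i+1, j+1), a vertex of G by column continuity; its left and upper
-- neighbours are matched inside the bracket. If it is (i+2, j+1), switching the vertical pairs in rows
-- i+1, i+2 and then the top square of the bracket produces {(i,j),(i+1,j)} and an (i+2, j, k-1)-bracket.
-- If it is (i+1, j+2), walking down column j+1 exhibits an (i+1, j+1, m)-bracket with m < k. It lies in
-- a narrower grid, so by induction it is straightened without touching column j; afterwards (i+1, j+1)
-- is matched downwards and the previous case applies.

open import Defs
open import Data.Nat using (ℕ; zero; suc; _+_; _*_; _≤_; _<_; z≤n; s≤s; _≟_)
open import Data.Nat.Properties
open import Data.Nat.Tactic.RingSolver using (solve-∀)
open import Data.Product using (Σ; _×_; _,_; proj₁; proj₂)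
open import Data.Product.Properties using (≡-dec)
open import Data.Sum using (_⊎_; inj₁; inj₂)
open import Data.Unit using (⊤; tt)
open import Data.Empty using (⊥-elim)
open import Function using (_∘_)
open import Relation.Nullary using (¬_; yes; no)
open import Relation.Binary.Definitions using (DecidableEquality)
open import Relation.Binary.PropositionalEquality
open import Function.Bundles using (_⇔_; mk⇔; Equivalence)
open import Relation.Binary.Construct.Closure.ReflexiveTransitive using (Star; ε; _◅_; _◅◅_)
  renaming (map to Star-map)

open PerfectMatching using () renaming (sym to reversed; edges to matched-edge; perfect to partner)

data Neighbour : Vertex → Vertex → Set where
  right : ∀ {a b} → Neighbour (a , b) (a , suc b)
  left  : ∀ {a b} → Neighbour (a , suc b) (a , b)
  down  : ∀ {a b} → Neighbour (a , b) (suc a , b)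
  up    : ∀ {a b} → Neighbour (suc a , b) (a , b)

Adj⇒Neighbour : ∀ {u v} → Adj u v → Neighbour u v
Adj⇒Neighbour {_ , _} {_ , _} (inj₁ (refl , inj₁ refl)) = right
Adj⇒Neighbour {_ , _} {_ , _} (inj₁ (refl , inj₂ refl)) = left
Adj⇒Neighbour {_ , _} {_ , _} (inj₂ (refl , inj₁ refl)) = down
Adj⇒Neighbour {_ , _} {_ , _} (inj₂ (refl , inj₂ refl)) = up

Neighbour⇒Adj : ∀ {u v} → Neighbour u v → Adj u v
Neighbour⇒Adj right = inj₁ (refl , inj₁ refl)
Neighbour⇒Adj left  = inj₁ (refl , inj₂ refl)
Neighbour⇒Adj down  = inj₂ (refl , inj₁ refl)
Neighbour⇒Adj up    = inj₂ (refl , inj₂ refl)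

Neighbour-sym : ∀ {u v} → Neighbour u v → Neighbour v u
Neighbour-sym right = left
Neighbour-sym left  = right
Neighbour-sym down  = up
Neighbour-sym up    = down

Adj-sym : ∀ {u v} → Adj u v → Adj v u
Adj-sym = Neighbour⇒Adj ∘ Neighbour-sym ∘ Adj⇒Neighbour

Adj⇒≢ : ∀ {u v} → Adj u v → u ≢ v
Adj⇒≢ adj refl with Adj⇒Neighbour adj
... | ()

_≟ᵥ_ : DecidableEquality Vertex
_≟ᵥ_ = ≡-dec _≟_ _≟_

row≢ : ∀ {r r' c c' : ℕ} → r ≢ r' → (r , c) ≢ (r' , c')
row≢ r≢r' e = r≢r' (cong proj₁ e)

EdgeOf-sym : ∀ {n} {G : Subgrid n} {u v} → EdgeOf G u v → EdgeOf G v u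
EdgeOf-sym (u∈G , v∈G , adj) = v∈G , u∈G , Adj-sym adj

PartnerOf : EdgeSet → Vertex → Set
PartnerOf M u = Σ Vertex λ v → M u v × (∀ w → M u w → w ≡ v)

_⊆ᴱ_ : EdgeSet → EdgeSet → Set
M ⊆ᴱ M' = ∀ x y → M x y → M' x y

PartnerOf-map : ∀ {M M' : EdgeSet} {u} → M ⊆ᴱ M' → M' ⊆ᴱ M → PartnerOf M u → PartnerOf M' u
PartnerOf-map to from (v , m , unique) = v , to _ _ m , λ w m' → unique w (from _ _ m')

module _ {n} {G : Subgrid n} {M : EdgeSet} (pm : PerfectMatching G M) where

  source-∈V : ∀ {u v} → M u v → V G u
  source-∈V m = proj₁ (matched-edge pm _ _ m)

  target-∈V : ∀ {u v} → M u v → V G v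
  target-∈V m = proj₁ (proj₂ (matched-edge pm _ _ m))

  matched-neighbour : ∀ {u v} → M u v → Neighbour u v
  matched-neighbour m = Adj⇒Neighbour (proj₂ (proj₂ (matched-edge pm _ _ m)))

  matched-≢ : ∀ {u v} → M u v → u ≢ v
  matched-≢ m = Adj⇒≢ (proj₂ (proj₂ (matched-edge pm _ _ m)))

  partner-unique : ∀ {u v w} → M u v → M u w → v ≡ w
  partner-unique {u} m m' with partner pm u (source-∈V m)
  ... | _ , _ , unique = trans (unique _ m) (sym (unique _ m'))

PerfectMatching-resp : ∀ {n} {G : Subgrid n} {M M' : EdgeSet} →
  M ⊆ᴱ M' → M' ⊆ᴱ M → PerfectMatching G M → PerfectMatching G M'
PerfectMatching-resp to from pm = record
  { sym     = λ x y m → to y x (reversed pm x y (from x y m))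
  ; edges   = λ x y m → matched-edge pm x y (from x y m)
  ; perfect = λ u u∈G → PartnerOf-map to from (partner pm u u∈G)
  }

SameEdge-flip : ∀ {x y a b} → SameEdge x y a b → SameEdge x y b a
SameEdge-flip (inj₁ (x≡a , y≡b)) = inj₂ (x≡a , y≡b)
SameEdge-flip (inj₂ (x≡b , y≡a)) = inj₁ (x≡b , y≡a)

SameEdge-swap : ∀ {x y a b} → SameEdge x y a b → SameEdge y x a b
SameEdge-swap (inj₁ (x≡a , y≡b)) = inj₂ (y≡b , x≡a)
SameEdge-swap (inj₂ (x≡b , y≡a)) = inj₁ (y≡a , x≡b)

-- An inductive copy of the matching produced by a 2-switch in Switch, so that its corners can be inferred.
data Switched (M : EdgeSet) (u₁ v₁ u₂ v₂ : Vertex) : EdgeSet where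
  kept    : ∀ {x y} → M x y → ¬ SameEdge x y u₁ v₁ → ¬ SameEdge x y u₂ v₂ → Switched M u₁ v₁ u₂ v₂ x y
  joined₁ : ∀ {x y} → SameEdge x y u₁ u₂ → Switched M u₁ v₁ u₂ v₂ x y
  joined₂ : ∀ {x y} → SameEdge x y v₁ v₂ → Switched M u₁ v₁ u₂ v₂ x y

module _ {M : EdgeSet} {u₁ v₁ u₂ v₂ : Vertex} where

  Switched⇔ : ∀ {x y} → Switched M u₁ v₁ u₂ v₂ x y ⇔
    ((M x y × ¬ SameEdge x y u₁ v₁ × ¬ SameEdge x y u₂ v₂) ⊎ SameEdge x y u₁ u₂ ⊎ SameEdge x y v₁ v₂)
  Switched⇔ = mk⇔ (λ { (kept m ¬e₁ ¬e₂) → inj₁ (m , ¬e₁ , ¬e₂)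
                     ; (joined₁ e) → inj₂ (inj₁ e)
                     ; (joined₂ e) → inj₂ (inj₂ e) })
                  (λ { (inj₁ (m , ¬e₁ , ¬e₂)) → kept m ¬e₁ ¬e₂
                     ; (inj₂ (inj₁ e)) → joined₁ e
                     ; (inj₂ (inj₂ e)) → joined₂ e })

  Switched-new₁ : Switched M u₁ v₁ u₂ v₂ u₁ u₂
  Switched-new₁ = joined₁ (inj₁ (refl , refl))

  Switched-new₂ : Switched M u₁ v₁ u₂ v₂ v₁ v₂
  Switched-new₂ = joined₂ (inj₁ (refl , refl))

  Switched-keeps : ∀ {x y} → M x y → x ≢ u₁ → x ≢ v₁ → x ≢ u₂ → x ≢ v₂ → Switched M u₁ v₁ u₂ v₂ x y
  Switched-keeps m x≢u₁ x≢v₁ x≢u₂ x≢v₂ = kept m (away x≢u₁ x≢v₁) (away x≢u₂ x≢v₂)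
    where
    away : ∀ {x y a b} → x ≢ a → x ≢ b → ¬ SameEdge x y a b
    away x≢a x≢b (inj₁ (x≡a , _)) = x≢a x≡a
    away x≢a x≢b (inj₂ (x≡b , _)) = x≢b x≡b

  Switched-exchange : Switched M u₁ v₁ u₂ v₂ ⊆ᴱ Switched M u₂ v₂ u₁ v₁
  Switched-exchange x y (kept m ¬e₁ ¬e₂) = kept m ¬e₂ ¬e₁
  Switched-exchange x y (joined₁ e)      = joined₁ (SameEdge-flip e)
  Switched-exchange x y (joined₂ e)      = joined₂ (SameEdge-flip e)

  Switched-reverse : Switched M u₁ v₁ u₂ v₂ ⊆ᴱ Switched M v₁ u₁ v₂ u₂
  Switched-reverse x y (kept m ¬e₁ ¬e₂) = kept m (¬e₁ ∘ SameEdge-flip) (¬e₂ ∘ SameEdge-flip)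
  Switched-reverse x y (joined₁ e)      = joined₂ e
  Switched-reverse x y (joined₂ e)      = joined₁ e

  Switched-turn : Switched M u₁ v₁ u₂ v₂ ⊆ᴱ Switched M v₂ u₂ v₁ u₁
  Switched-turn x y (kept m ¬e₁ ¬e₂) = kept m (¬e₂ ∘ SameEdge-flip) (¬e₁ ∘ SameEdge-flip)
  Switched-turn x y (joined₁ e)      = joined₂ (SameEdge-flip e)
  Switched-turn x y (joined₂ e)      = joined₁ (SameEdge-flip e)

  Switched-sym : (∀ x y → M x y → M y x) → ∀ x y → Switched M u₁ v₁ u₂ v₂ x y → Switched M u₁ v₁ u₂ v₂ y x
  Switched-sym M-sym x y (kept m ¬e₁ ¬e₂) = kept (M-sym x y m) (¬e₁ ∘ SameEdge-swap) (¬e₂ ∘ SameEdge-swap)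
  Switched-sym M-sym x y (joined₁ e)      = joined₁ (SameEdge-swap e)
  Switched-sym M-sym x y (joined₂ e)      = joined₂ (SameEdge-swap e)

  Switched-corner-partner : M u₁ v₁ → (∀ w → M u₁ w → w ≡ v₁) → u₁ ≢ v₁ → u₁ ≢ u₂ → u₁ ≢ v₂ →
    PartnerOf (Switched M u₁ v₁ u₂ v₂) u₁
  Switched-corner-partner m unique u₁≢v₁ u₁≢u₂ u₁≢v₂ = u₂ , Switched-new₁ , unique'
    where
    unique' : ∀ w → Switched M u₁ v₁ u₂ v₂ u₁ w → w ≡ u₂
    unique' w (kept m' ¬e₁ _)                 = ⊥-elim (¬e₁ (inj₁ (refl , unique w m')))
    unique' w (joined₁ (inj₁ (_ , w≡u₂)))     = w≡u₂
    unique' w (joined₁ (inj₂ (u₁≡u₂ , _)))    = ⊥-elim (u₁≢u₂ u₁≡u₂)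
    unique' w (joined₂ (inj₁ (u₁≡v₁ , _)))    = ⊥-elim (u₁≢v₁ u₁≡v₁)
    unique' w (joined₂ (inj₂ (u₁≡v₂ , _)))    = ⊥-elim (u₁≢v₂ u₁≡v₂)

  Switched-other-partner : ∀ {u} → u ≢ u₁ → u ≢ v₁ → u ≢ u₂ → u ≢ v₂ →
    PartnerOf M u → PartnerOf (Switched M u₁ v₁ u₂ v₂) u
  Switched-other-partner u≢u₁ u≢v₁ u≢u₂ u≢v₂ (v , m , unique) =
    v , Switched-keeps m u≢u₁ u≢v₁ u≢u₂ u≢v₂ , unique'
    where
    unique' : ∀ w → Switched M u₁ v₁ u₂ v₂ _ w → w ≡ v
    unique' w (kept m' _ _)                 = unique w m'
    unique' w (joined₁ (inj₁ (u≡u₁ , _)))   = ⊥-elim (u≢u₁ u≡u₁)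
    unique' w (joined₁ (inj₂ (u≡u₂ , _)))   = ⊥-elim (u≢u₂ u≡u₂)
    unique' w (joined₂ (inj₁ (u≡v₁ , _)))   = ⊥-elim (u≢v₁ u≡v₁)
    unique' w (joined₂ (inj₂ (u≡v₂ , _)))   = ⊥-elim (u≢v₂ u≡v₂)

Switched-PerfectMatching : ∀ {n} {G : Subgrid n} {M : EdgeSet} {u₁ v₁ u₂ v₂} → PerfectMatching G M →
  M u₁ v₁ → M u₂ v₂ → ¬ SameEdge u₁ v₁ u₂ v₂ → EdgeOf G u₁ u₂ → EdgeOf G v₁ v₂ →
  PerfectMatching G (Switched M u₁ v₁ u₂ v₂)
Switched-PerfectMatching {G = G} {M} {u₁} {v₁} {u₂} {v₂} pm m₁ m₂ different e₁ e₂ = record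
  { sym     = Switched-sym (reversed pm)
  ; edges   = switched-edge
  ; perfect = perfect
  }
  where
  switched-edge : ∀ x y → Switched M u₁ v₁ u₂ v₂ x y → EdgeOf G x y
  switched-edge x y (kept m _ _)                = matched-edge pm x y m
  switched-edge x y (joined₁ (inj₁ (refl , refl))) = e₁
  switched-edge x y (joined₁ (inj₂ (refl , refl))) = EdgeOf-sym {G = G} e₁
  switched-edge x y (joined₂ (inj₁ (refl , refl))) = e₂
  switched-edge x y (joined₂ (inj₂ (refl , refl))) = EdgeOf-sym {G = G} e₂

  unique : ∀ {u v} → M u v → ∀ w → M u w → w ≡ v
  unique m w m' = partner-unique pm m' m

  u₁≢u₂ : u₁ ≢ u₂
  u₁≢u₂ = Adj⇒≢ (proj₂ (proj₂ e₁))
  v₁≢v₂ : v₁ ≢ v₂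
  v₁≢v₂ = Adj⇒≢ (proj₂ (proj₂ e₂))
  u₁≢v₂ : u₁ ≢ v₂
  u₁≢v₂ refl = different (inj₂ (refl , partner-unique pm m₁ (reversed pm _ _ m₂)))
  v₁≢u₂ : v₁ ≢ u₂
  v₁≢u₂ refl = different (inj₂ (partner-unique pm (reversed pm _ _ m₁) m₂ , refl))

  perfect : ∀ u → V G u → PartnerOf (Switched M u₁ v₁ u₂ v₂) u
  perfect u u∈G with u ≟ᵥ u₁ | u ≟ᵥ u₂ | u ≟ᵥ v₁ | u ≟ᵥ v₂
  ... | yes refl | _ | _ | _ =
    Switched-corner-partner m₁ (unique m₁) (matched-≢ pm m₁) u₁≢u₂ u₁≢v₂
  ... | no _ | yes refl | _ | _ =
    PartnerOf-map Switched-exchange Switched-exchange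
      (Switched-corner-partner m₂ (unique m₂) (matched-≢ pm m₂) (u₁≢u₂ ∘ sym) (v₁≢u₂ ∘ sym))
  ... | no _ | no _ | yes refl | _ =
    PartnerOf-map Switched-reverse Switched-reverse
      (Switched-corner-partner m₁′ (unique m₁′) (matched-≢ pm m₁′) v₁≢v₂ v₁≢u₂)
    where m₁′ = reversed pm _ _ m₁
  ... | no _ | no _ | no _ | yes refl =
    PartnerOf-map Switched-turn Switched-turn
      (Switched-corner-partner m₂′ (unique m₂′) (matched-≢ pm m₂′) (v₁≢v₂ ∘ sym) (u₁≢v₂ ∘ sym))
    where m₂′ = reversed pm _ _ m₂
  ... | no u≢u₁ | no u≢u₂ | no u≢v₁ | no u≢v₂ =
    Switched-other-partner u≢u₁ u≢v₁ u≢u₂ u≢v₂ (partner pm u u∈G)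

module OnSubgrid {n} (G : Subgrid n) where

  switch : ∀ {T : Vertex → Set} {M : EdgeSet} {u₁ v₁ u₂ v₂} →
    M u₁ v₁ → M u₂ v₂ → ¬ SameEdge u₁ v₁ u₂ v₂ → EdgeOf G u₁ u₂ → EdgeOf G v₁ v₂ →
    T u₁ → T v₁ → T u₂ → T v₂ → Switch G T M (Switched M u₁ v₁ u₂ v₂)
  switch m₁ m₂ different e₁ e₂ t₁ t₂ t₃ t₄ =
    _ , _ , _ , _ , m₁ , m₂ , different , e₁ , e₂ , t₁ , t₂ , t₃ , t₄ , λ _ _ → Switched⇔

  Switch-PerfectMatching : ∀ {T M M'} → PerfectMatching G M → Switch G T M M' → PerfectMatching G M'
  Switch-PerfectMatching pm (_ , _ , _ , _ , m₁ , m₂ , different , e₁ , e₂ , _ , _ , _ , _ , M'⇔) =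
    PerfectMatching-resp (λ x y → Equivalence.from (M'⇔ x y) ∘ Equivalence.to Switched⇔)
                         (λ x y → Equivalence.from Switched⇔ ∘ Equivalence.to (M'⇔ x y))
                         (Switched-PerfectMatching pm m₁ m₂ different e₁ e₂)

  Switch-mono : ∀ {T T' : Vertex → Set} {M M'} → (∀ v → T v → T' v) → Switch G T M M' → Switch G T' M M'
  Switch-mono T⊆T' (u₁ , v₁ , u₂ , v₂ , m₁ , m₂ , different , e₁ , e₂ , t₁ , t₂ , t₃ , t₄ , M'⇔) =
    u₁ , v₁ , u₂ , v₂ , m₁ , m₂ , different , e₁ , e₂ , T⊆T' _ t₁ , T⊆T' _ t₂ , T⊆T' _ t₃ , T⊆T' _ t₄ , M'⇔

  Switch-keeps-outside : ∀ {T : Vertex → Set} {M M'} → Switch G T M M' → ∀ {x y} → ¬ T x → M x y → M' x y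
  Switch-keeps-outside {T} {M} (_ , _ , _ , _ , _ , _ , _ , _ , _ , t₁ , t₂ , t₃ , t₄ , M'⇔) {x} {y} x∉T m =
    Equivalence.from (M'⇔ x y) (Equivalence.to (Switched⇔ {M = M})
      (Switched-keeps m (outside t₁) (outside t₂) (outside t₃) (outside t₄)))
    where
    outside : ∀ {z} → T z → x ≢ z
    outside z∈T refl = x∉T z∈T

  Star-keeps-outside : ∀ {T : Vertex → Set} {M M'} → Star (Switch G T) M M' → ∀ {x y} → ¬ T x → M x y → M' x y
  Star-keeps-outside ε           x∉T m = m
  Star-keeps-outside (s ◅ steps) x∉T m = Star-keeps-outside steps x∉T (Switch-keeps-outside s x∉T m)

  SquareWithin : (Vertex → Set) → ℕ → ℕ → Set
  SquareWithin T a b = ∀ {r c} → a ≤ r → r ≤ suc a → b ≤ c → c ≤ suc b → V G (r , c) → T (r , c)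

  rotate-horizontal : ∀ {T M a b} → PerfectMatching G M → SquareWithin T a b →
    M (a , b) (a , suc b) → M (suc a , b) (suc a , suc b) →
    Switch G T M (Switched M (a , b) (a , suc b) (suc a , b) (suc a , suc b))
  rotate-horizontal {a = a} {b} pm square top bottom =
    switch top bottom (λ { (inj₁ (() , _)) ; (inj₂ (() , _)) })
      (source-∈V pm top , source-∈V pm bottom , Neighbour⇒Adj down)
      (target-∈V pm top , target-∈V pm bottom , Neighbour⇒Adj down)
      (square ≤-refl (n≤1+n a) ≤-refl (n≤1+n b) (source-∈V pm top))
      (square ≤-refl (n≤1+n a) (n≤1+n b) ≤-refl (target-∈V pm top))
      (square (n≤1+n a) ≤-refl ≤-refl (n≤1+n b) (source-∈V pm bottom))
      (square (n≤1+n a) ≤-refl (n≤1+n b) ≤-refl (target-∈V pm bottom))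

  rotate-vertical : ∀ {T M a b} → PerfectMatching G M → SquareWithin T a b →
    M (a , b) (suc a , b) → M (a , suc b) (suc a , suc b) →
    Switch G T M (Switched M (a , b) (suc a , b) (a , suc b) (suc a , suc b))
  rotate-vertical {a = a} {b} pm square left-edge right-edge =
    switch left-edge right-edge (λ { (inj₁ (() , _)) ; (inj₂ (() , _)) })
      (source-∈V pm left-edge , source-∈V pm right-edge , Neighbour⇒Adj right)
      (target-∈V pm left-edge , target-∈V pm right-edge , Neighbour⇒Adj right)
      (square ≤-refl (n≤1+n a) ≤-refl (n≤1+n b) (source-∈V pm left-edge))
      (square (n≤1+n a) ≤-refl ≤-refl (n≤1+n b) (target-∈V pm left-edge))
      (square ≤-refl (n≤1+n a) (n≤1+n b) ≤-refl (source-∈V pm right-edge))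
      (square (n≤1+n a) ≤-refl (n≤1+n b) ≤-refl (target-∈V pm right-edge))

  TRegion-mono : ∀ {i j k i' j' k'} → i ≤ i' → i' + 2 * k' + 1 ≤ i + 2 * k + 1 → j ≤ j' →
    ∀ v → TRegion G i' j' k' v → TRegion G i j k v
  TRegion-mono i≤i' last'≤last j≤j' _ ((i'≤r , r≤last') , (j'≤c , c≤n) , v∈G) =
    (≤-trans i≤i' i'≤r , ≤-trans r≤last' last'≤last) , (≤-trans j≤j' j'≤c , c≤n) , v∈G

  TRegion-square : ∀ {i j k a b} → i ≤ a → suc a ≤ i + 2 * k + 1 → j ≤ b → SquareWithin (TRegion G i j k) a b
  TRegion-square i≤a a+1≤last j≤b a≤r r≤a+1 b≤c _ v∈G =
    (≤-trans i≤a a≤r , ≤-trans r≤a+1 a+1≤last) , (≤-trans j≤b b≤c , proj₂ (proj₂ (inGrid G _ v∈G))) , v∈G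

subst-rows : ∀ {M : EdgeSet} {r r' s s' c c'} → r ≡ r' → s ≡ s' → M (r , c) (s , c') → M (r' , c) (s' , c')
subst-rows refl refl m = m

first-rows : ∀ i d → i + 2 * 0 + d ≡ d + i
first-rows = solve-∀

shifted-rows : ∀ i t → i + 2 * suc t ≡ suc (suc i) + 2 * t
shifted-rows = solve-∀

last-row-shift : ∀ i k → i + 2 * suc k + 1 ≡ suc (suc i) + 2 * k + 1
last-row-shift i k = cong (_+ 1) (shifted-rows i k)

beside-last-row : ∀ i {m k} → m ≤ k → suc i + 2 * m + 1 ≤ i + 2 * suc k + 1
beside-last-row i {m} {k} m≤k = subst (suc i + 2 * m + 1 ≤_) (sym (last-row-shift i k))
  (≤-trans (+-monoˡ-≤ 1 (+-monoʳ-≤ (suc i) (*-monoʳ-≤ 2 m≤k))) (n≤1+n _))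

below-first-row : ∀ i k → suc i ≤ i + 2 * k + 1
below-first-row i k = subst (suc i ≤_) (+-comm 1 (i + 2 * k)) (s≤s (m≤m+n i (2 * k)))

BracketTail : EdgeSet → ℕ → ℕ → ℕ → Set
BracketTail M a j zero    = M (a , j) (a , suc j)
BracketTail M a j (suc k) = M (a , j) (suc a , j) × BracketTail M (suc (suc a)) j k

Bracket : EdgeSet → ℕ → ℕ → ℕ → Set
Bracket M i j k = M (i , j) (i , suc j) × BracketTail M (suc i) j k

VerticalPairs : EdgeSet → ℕ → ℕ → ℕ → Set
VerticalPairs M a j zero    = ⊤
VerticalPairs M a j (suc k) = M (a , j) (suc a , j) × VerticalPairs M (suc (suc a)) j k

BracketTail-bottom : ∀ {M a j} k → BracketTail M a j k → Σ ℕ λ b → a ≤ b × M (b , j) (b , suc j)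
BracketTail-bottom zero    bottom = _ , ≤-refl , bottom
BracketTail-bottom {a = a} (suc k) (_ , tail) with BracketTail-bottom k tail
... | b , a+2≤b , bottom = b , ≤-trans (m≤n+m a 2) a+2≤b , bottom

BracketTail-map : ∀ {M M' : EdgeSet} {a j} k → (∀ {r y} → a ≤ r → M (r , j) y → M' (r , j) y) →
  BracketTail M a j k → BracketTail M' a j k
BracketTail-map zero    keep bottom = keep ≤-refl bottom
BracketTail-map {a = a} (suc k) keep (first , tail) =
  keep ≤-refl first , BracketTail-map k (λ a+2≤r → keep (≤-trans (m≤n+m a 2) a+2≤r)) tail

HasBracket⇒BracketTail : ∀ {M j} i k → (∀ t → t < k → M (i + 2 * t + 1 , j) (i + 2 * t + 2 , j)) →
  M (i + 2 * k + 1 , j) (i + 2 * k + 1 , suc j) → BracketTail M (suc i) j k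
HasBracket⇒BracketTail {M} i zero _ bottom =
  subst-rows {M = M} (first-rows i 1) (first-rows i 1) bottom
HasBracket⇒BracketTail {M} i (suc k) vertical bottom =
  subst-rows {M = M} (first-rows i 1) (first-rows i 2) (vertical 0 (s≤s z≤n)) ,
  HasBracket⇒BracketTail (suc (suc i)) k
    (λ t t<k → subst-rows {M = M} (cong (_+ 1) (shifted-rows i t)) (cong (_+ 2) (shifted-rows i t))
                          (vertical (suc t) (s≤s t<k)))
    (subst-rows {M = M} (last-row-shift i k) (last-row-shift i k) bottom)

HasBracket⇒Bracket : ∀ {M i j k} → HasBracket M i j k → Bracket M i j k
HasBracket⇒Bracket {i = i} {k = k} (top , vertical , bottom) =
  top , HasBracket⇒BracketTail i k vertical bottom

VerticalPairs⇒HasVerticalColumn : ∀ {M i j} k → VerticalPairs M i j (suc k) → HasVerticalColumn M i j k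
VerticalPairs⇒HasVerticalColumn {M} {i} _ (first , _) zero _ =
  subst-rows {M = M} (sym (+-identityʳ i)) (sym (first-rows i 1)) first
VerticalPairs⇒HasVerticalColumn {M} {i} (suc k) (_ , rest) (suc t) (s≤s t≤k) =
  subst-rows {M = M} (sym (shifted-rows i t)) (sym (cong (_+ 1) (shifted-rows i t)))
    (VerticalPairs⇒HasVerticalColumn k rest t t≤k)

module Straightening {n} (G : Subgrid n) (continuous : ColumnContinuous G) where

  open OnSubgrid G

  Straightened : EdgeSet → ℕ → ℕ → ℕ → Set₁
  Straightened M i j k = Σ EdgeSet λ M' →
    Star (Switch G (TRegion G i j k)) M M' × PerfectMatching G M' × VerticalPairs M' i j (suc k)

  beside-BracketTail-∈V : ∀ {M a j r x} k → PerfectMatching G M → BracketTail M a j k →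
    V G (r , suc j) → r ≤ x → x ≤ a → V G (x , suc j)
  beside-BracketTail-∈V k pm tail r∈G r≤x x≤a with BracketTail-bottom k tail
  ... | b , a≤b , bottom = continuous _ b _ _ r∈G (target-∈V pm bottom) r≤x (≤-trans x≤a a≤b)

  straighten-square : ∀ {M i j} → PerfectMatching G M → Bracket M i j 0 → Straightened M i j 0
  straighten-square {i = i} pm (top , bottom) =
    _ , step ◅ ε , Switch-PerfectMatching pm step , Switched-new₁ , tt
    where
    step = rotate-horizontal pm (TRegion-square {k = 0} ≤-refl (below-first-row i 0) ≤-refl) top bottom

  straighten-down : ∀ {M i j k} → PerfectMatching G M → Bracket M i j (suc k) →
    M (suc i , suc j) (suc (suc i) , suc j) →
    (∀ {M'} → PerfectMatching G M' → Bracket M' (suc (suc i)) j k → Straightened M' (suc (suc i)) j k) →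
    Straightened M i j (suc k)
  straighten-down {M} {i} {j} {k} pm (top , middle , tail) beside straighten-rest =
    finish (straighten-rest pm₃ (top₃ , BracketTail-map k below tail))
    where
    T = TRegion G i j (suc k)
    M₂ = Switched M (suc i , j) (suc (suc i) , j) (suc i , suc j) (suc (suc i) , suc j)
    step₁ : Switch G T M M₂
    step₁ = rotate-vertical pm (TRegion-square {k = suc k} (n≤1+n i) third-row≤last ≤-refl) middle beside
      where
      third-row≤last : suc (suc i) ≤ i + 2 * suc k + 1
      third-row≤last = subst (suc (suc i) ≤_) (sym (last-row-shift i k))
                             (≤-trans (below-first-row (suc i) k) (n≤1+n _))
    pm₂ = Switch-PerfectMatching pm step₁

    M₃ = Switched M₂ (i , j) (i , suc j) (suc i , j) (suc i , suc j)
    step₂ : Switch G T M₂ M₃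
    step₂ = rotate-horizontal pm₂ (TRegion-square {k = suc k} ≤-refl (below-first-row i (suc k)) ≤-refl)
              (Switched-keeps top (row≢ λ ()) (row≢ λ ()) (row≢ λ ()) (row≢ λ ())) Switched-new₁
    pm₃ = Switch-PerfectMatching pm₂ step₂

    top₃ : M₃ (suc (suc i) , j) (suc (suc i) , suc j)
    top₃ = Switched-keeps Switched-new₂ (row≢ λ ()) (row≢ λ ()) (row≢ λ ()) (row≢ λ ())

    below : ∀ {r y} → 3 + i ≤ r → M (r , j) y → M₃ (r , j) y
    below 3+i≤r m = Switched-keeps (Switched-keeps m (row≢ r≢1+i) (row≢ r≢2+i) (row≢ r≢1+i) (row≢ r≢2+i))
                                   (row≢ r≢i) (row≢ r≢i) (row≢ r≢1+i) (row≢ r≢1+i)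
      where
      r≢2+i = >⇒≢ 3+i≤r
      r≢1+i = >⇒≢ (≤-trans (n≤1+n _) 3+i≤r)
      r≢i   = >⇒≢ (≤-trans (m≤n+m _ 2) 3+i≤r)

    first-row-outside : ¬ TRegion G (suc (suc i)) j k (i , j)
    first-row-outside ((2+i≤i , _) , _) = n≮n i (≤-trans (n≤1+n (suc i)) 2+i≤i)

    rest-inside : ∀ v → TRegion G (suc (suc i)) j k v → T v
    rest-inside = TRegion-mono {k = suc k} {k' = k} (m≤n+m i 2)
                    (≤-reflexive (sym (last-row-shift i k))) ≤-refl

    finish : Straightened M₃ (suc (suc i)) j k → Straightened M i j (suc k)
    finish (M₄ , steps , pm₄ , pairs) =
      M₄ , step₁ ◅ step₂ ◅ Star-map (Switch-mono rest-inside) steps ,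
      pm₄ , Star-keeps-outside steps first-row-outside Switched-new₁ , pairs

  Straightened-prepend : ∀ {M M₁ i j k} → Star (Switch G (TRegion G i j k)) M M₁ →
    Straightened M₁ i j k → Straightened M i j k
  Straightened-prepend steps (M' , steps' , pm' , pairs) = M' , steps ◅◅ steps' , pm' , pairs

  -- Walk down column j+1 beside the tail: every vertex is matched downwards until one is matched to
  -- the right, and the bottom edge of the tail stops the walk before it passes the tail.
  scan-column : ∀ {M a j} k → PerfectMatching G M → BracketTail M a j (suc k) →
    Σ Vertex (λ w → M (a , suc j) w × w ≢ (suc a , suc j)) →
    Σ ℕ λ m → m ≤ k × BracketTail M (suc a) (suc j) m
  scan-column {M} {a} {j} k pm (left-edge , tail) (w , above , w≢below) =
    continue (proj₁ (proj₂ next)) (matched-neighbour pm (proj₁ (proj₂ next)))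
    where
    next = partner pm (suc a , suc j)
             (beside-BracketTail-∈V k pm tail (source-∈V pm above) (n≤1+n a) (n≤1+n (suc a)))

    descend : ∀ k' → BracketTail M (suc (suc a)) j k' → M (suc a , suc j) (suc (suc a) , suc j) →
      Σ ℕ λ m → m ≤ k' × BracketTail M (suc a) (suc j) m
    descend zero bottom e with partner-unique pm (reversed pm _ _ bottom) (reversed pm _ _ e)
    ... | ()
    descend (suc k') tail' e with scan-column k' pm tail' (_ , reversed pm _ _ e , λ ())
    ... | m , m≤k' , rest = suc m , s≤s m≤k' , e , rest

    continue : ∀ {v} → M (suc a , suc j) v → Neighbour (suc a , suc j) v →
      Σ ℕ λ m → m ≤ k × BracketTail M (suc a) (suc j) m
    continue e right = 0 , z≤n , e
    continue e left with partner-unique pm (reversed pm _ _ left-edge) (reversed pm _ _ e)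
    ... | ()
    continue e up   = ⊥-elim (w≢below (partner-unique pm above (reversed pm _ _ e)))
    continue e down = descend k tail e

  clear-beside : ∀ {M i j k} →
    (∀ {M' m} → PerfectMatching G M' → Bracket M' (suc i) (suc j) m → Straightened M' (suc i) (suc j) m) →
    PerfectMatching G M → Bracket M i j (suc k) → M (suc i , suc j) (suc i , suc (suc j)) →
    Σ EdgeSet λ M₁ → Star (Switch G (TRegion G i j (suc k))) M M₁ × PerfectMatching G M₁ ×
      Bracket M₁ i j (suc k) × M₁ (suc i , suc j) (suc (suc i) , suc j)
  clear-beside {M} {i} {j} {k} straighten-beside pm (top , tail) right-edge
    with scan-column k pm tail (_ , right-edge , λ ())
  ... | m , m≤k , tail' with straighten-beside {m = m} pm (right-edge , tail')
  ... | M₁ , steps , pm₁ , (down₁ , _) =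
    M₁ , Star-map (Switch-mono beside-inside) steps ,
    pm₁ , (column-kept top , BracketTail-map (suc k) (λ _ → column-kept) tail) , down₁
    where
    beside-inside : ∀ v → TRegion G (suc i) (suc j) m v → TRegion G i j (suc k) v
    beside-inside = TRegion-mono {k = suc k} {k' = m} (n≤1+n i) (beside-last-row i m≤k) (n≤1+n j)

    column-kept : ∀ {r y} → M (r , j) y → M₁ (r , j) y
    column-kept = Star-keeps-outside steps λ { (_ , (j+1≤j , _) , _) → n≮n j j+1≤j }

  StraightenableWithin : ℕ → Set₁
  StraightenableWithin w =
    ∀ {M i j k} → n ≤ j + w → PerfectMatching G M → Bracket M i j k → Straightened M i j k

  straighten-right : ∀ {M i j k} w → (∀ {w'} → w ≡ suc w' → StraightenableWithin w') → n ≤ j + w →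
    PerfectMatching G M → Bracket M i j (suc k) → M (suc i , suc j) (suc i , suc (suc j)) →
    (∀ {M'} → PerfectMatching G M' → Bracket M' (suc (suc i)) j k → Straightened M' (suc (suc i)) j k) →
    Straightened M i j (suc k)
  straighten-right {j = j} zero _ n≤j+0 pm _ right-edge _ =
    ⊥-elim (n≮n j (≤-trans (n≤1+n (suc j)) (≤-trans j+2≤n (≤-trans n≤j+0 (≤-reflexive (+-identityʳ j))))))
    where
    j+2≤n : suc (suc j) ≤ n
    j+2≤n = proj₂ (proj₂ (inGrid G _ (target-∈V pm right-edge)))
  straighten-right {j = j} (suc w) narrower n≤j+w pm bracket right-edge straighten-rest
    with clear-beside (narrower refl (subst (n ≤_) (+-suc j w) n≤j+w)) pm bracket right-edge
  ... | M₁ , steps , pm₁ , bracket₁ , down₁ =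
    Straightened-prepend steps (straighten-down pm₁ bracket₁ down₁ straighten-rest)

  straighten-within : ∀ w → (∀ {w'} → w ≡ suc w' → StraightenableWithin w') → StraightenableWithin w
  straighten-within w narrower {k = zero} _ pm bracket = straighten-square pm bracket
  straighten-within w narrower {M} {i} {j} {suc k} n≤j+w pm bracket@(top , middle , tail) =
    by-partner (proj₁ (proj₂ next)) (matched-neighbour pm (proj₁ (proj₂ next)))
    where
    next = partner pm (suc i , suc j)
             (beside-BracketTail-∈V (suc k) pm (middle , tail) (target-∈V pm top) (n≤1+n i) ≤-refl)

    straighten-rest : ∀ {M'} → PerfectMatching G M' → Bracket M' (suc (suc i)) j k →
      Straightened M' (suc (suc i)) j k
    straighten-rest = straighten-within w narrower n≤j+w

    by-partner : ∀ {v} → M (suc i , suc j) v → Neighbour (suc i , suc j) v → Straightened M i j (suc k)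
    by-partner e right = straighten-right w narrower n≤j+w pm bracket e straighten-rest
    by-partner e down  = straighten-down pm bracket e straighten-rest
    by-partner e left with partner-unique pm middle (reversed pm _ _ e)
    ... | ()
    by-partner e up with partner-unique pm (reversed pm _ _ top) (reversed pm _ _ e)
    ... | ()

  straighten : ∀ w → StraightenableWithin w
  straighten zero    = straighten-within zero λ ()
  straighten (suc w) = straighten-within (suc w) λ { refl → straighten w }

mainTheorem7 : (n : ℕ) (G : Subgrid n) → ColumnContinuous G →
    (M : EdgeSet) → PerfectMatching G M →
    (i j k : ℕ) → HasBracket M i j k →
    Σ EdgeSet λ M' →
    Star (Switch G (TRegion G i j k)) M M' × PerfectMatching G M' × HasVerticalColumn M' i j k
mainTheorem7 n G continuous M pm i j k bracket
  with Straightening.straighten G continuous n (m≤n+m n j) pm (HasBracket⇒Bracket bracket)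
... | M' , steps , pm' , pairs = M' , steps , pm' , VerticalPairs⇒HasVerticalColumn k pairs
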